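{- Let $s \geq 1$ and $t \geq 2$ be integers and let $\beta_{s,t}$ be the type-$\beta$ comb with $s$ teeth of length $t$. Then the number of linear extensions of $\beta_{s,t}$ that avoid both patterns $312$ and $321$ equals $(t+1)^{s-1}$.
   Context: A linear extension of a finite poset $P$ on a set of integers is a listing $v=[v_1,\dots,v_n]$ of all elements of $P$, each exactly once, such that whenever $a \leq_P b$, $a$ appears before $b$. For $w \in S_3$, a sequence $v$ of distinct integers contains $w$ if there are indices $i<j<k$ with $(v_i,v_j,v_k)$ in the same relative order as $(w_1,w_2,w_3)$; otherwise $v$ avoids $w$. The type-$\beta$ comb $\beta_{s,t}$ is the poset on $\{1,\dots,st\}$ whose order is generated by the relations $ct+1 \leq (c+1)t+1$ for $0 \leq c \leq s-2$ (the spine) and $ct+j \leq ct+j+1$ for $0 \leq c \leq s-1$, $1 \leq j \leq t-1$ (the teeth $\{ct+1,\dots,ct+t\}$). -}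

module Defs where

open import Data.Nat using (ℕ; zero; suc; _+_; _*_; _∸_; _<_; _≤_)
open import Data.Product using (Σ; ∃; _×_; _,_)
open import Data.Fin using (Fin)
import Data.Fin as Fin
open import Data.List using (List; length; lookup; applyUpTo)
open import Data.List.Relation.Binary.Permutation.Propositional using (_↭_)
open import Relation.Binary.Construct.Closure.ReflexiveTransitive using (Star)
open import Relation.Binary.PropositionalEquality using (_≡_; _≢_)
open import Relation.Nullary using (¬_)
open import Function.Bundles using (_⇔_)

data Cover (s t : ℕ) : ℕ → ℕ → Set where
  spine : (c : ℕ) → suc c < s → Cover s t (c * t + 1) (suc c * t + 1)
  tooth : (c j : ℕ) → c < s → 1 ≤ j → j < t → Cover s t (c * t + j) (c * t + j + 1)

_≤β[_,_]_ : ℕ → ℕ → ℕ → ℕ → Set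
a ≤β[ s , t ] b = Star (Cover s t) a b

ground : ℕ → ℕ → List ℕ
ground s t = applyUpTo suc (s * t)

IsLinearExtension : ℕ → ℕ → List ℕ → Set
IsLinearExtension s t v =
  (v ↭ ground s t) ×
  (∀ a b → a ≤β[ s , t ] b → a ≢ b →
     Σ (Fin (length v)) λ i → Σ (Fin (length v)) λ j →
       (i Fin.< j) × (lookup v i ≡ a) × (lookup v j ≡ b))

SameOrd : ℕ → ℕ → ℕ → ℕ → Set
SameOrd x y p q = (x < y ⇔ p < q)

Contains : ℕ → ℕ → ℕ → List ℕ → Set
Contains w₁ w₂ w₃ v =
  Σ (Fin (length v)) λ i → Σ (Fin (length v)) λ j → Σ (Fin (length v)) λ k →
    (i Fin.< j) × (j Fin.< k) ×
    SameOrd (lookup v i) (lookup v j) w₁ w₂ ×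
    SameOrd (lookup v j) (lookup v i) w₂ w₁ ×
    SameOrd (lookup v i) (lookup v k) w₁ w₃ ×
    SameOrd (lookup v k) (lookup v i) w₃ w₁ ×
    SameOrd (lookup v j) (lookup v k) w₂ w₃ ×
    SameOrd (lookup v k) (lookup v j) w₃ w₂

Avoids : ℕ → ℕ → ℕ → List ℕ → Set
Avoids w₁ w₂ w₃ v = ¬ Contains w₁ w₂ w₃ v

-- A permutation avoids 312 and 321 exactly when every entry is followed by at
-- most one smaller entry, i.e. when it is the identity with some entries a moved
-- to the right past a run a+1, …, a+k.  In a linear extension of β_{s,t} only a
-- tooth top (a multiple of t) can be moved, since any other a must precede a+1;
-- conversely every such arrangement is a linear extension, because in each comb
-- relation a < b the smaller element a is not a top.  The arrangements are
-- produced by a left-to-right recursion carrying a delayed top along until it is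
-- released, and counting along it shows that each of the s-1 tops t, …, (s-1)t
-- multiplies their number by t+1.
module Submission where

open import Defs
open import Data.Nat using (ℕ; zero; suc; _+_; _*_; _∸_; _^_; _≤_; _<_; z≤n; s≤s; z<s; s<s)
open import Data.Nat.Properties
open import Data.Nat.Divisibility using (_∣_; _∣?_; ∣-refl; ∣⇒≤; ∣m+n∣m⇒∣n; ∣m∣n⇒∣m+n; n∣m*n; m%n≡0⇒n∣m)
open import Data.Nat.DivMod using (_%_; _/_; m≡m%n+[m/n]*n; m%n<n; m<n*o⇒m/o<n)
open import Data.Product using (Σ; _×_; _,_; proj₁; proj₂)
open import Data.Sum using (_⊎_; inj₁; inj₂; [_,_]′)
open import Data.Empty using (⊥; ⊥-elim)
open import Data.Fin using (Fin; zero; suc)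
import Data.Fin as Fin
import Data.Fin.Properties as Fin
open import Data.List using (List; []; _∷_; [_]; length; lookup; applyUpTo; map; _++_)
open import Data.List.Properties using (∷-injective; ∷-injectiveʳ; length-map; length-++)
open import Data.List.Membership.Propositional using (_∈_)
open import Data.List.Membership.Propositional.Properties using (∈-map⁺; ∈-map⁻; ∈-++⁺ˡ; ∈-++⁺ʳ; ∈-++⁻; ∈-lookup)
open import Data.List.Relation.Unary.Any as Any using (here; there)
open import Data.List.Relation.Unary.Any.Properties using (lookup-index)
open import Data.List.Relation.Unary.All as All using ([]; _∷_)
open import Data.List.Relation.Unary.AllPairs using (AllPairs; []; _∷_)
open import Data.List.Relation.Unary.Unique.Propositional using (Unique)
import Data.List.Relation.Unary.Unique.Propositional.Properties as Unique
open import Data.List.Relation.Binary.Disjoint.Propositional using (Disjoint)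
open import Data.List.Relation.Binary.Permutation.Propositional using (_↭_; ↭-refl; ↭-prep; ↭-swap; ↭-sym; ↭-trans; ↭⇒↭ₛ)
open import Data.List.Relation.Binary.Permutation.Propositional.Properties using (∈-resp-↭; drop-∷; ↭-empty-inv; ↭-singleton-inv; ¬x∷xs↭[])
open import Relation.Binary.Construct.Closure.ReflexiveTransitive using (ε; _◅_)
open import Relation.Binary.PropositionalEquality as ≡ using (_≡_; _≢_; refl; sym; cong; cong₂; subst; subst₂)
open import Data.List.Relation.Binary.Permutation.Setoid.Properties (≡.setoid ℕ) using (Unique-resp-↭)
open import Relation.Binary using (tri<; tri≈; tri>)
open import Relation.Nullary using (¬_; Dec; yes; no)
open import Relation.Nullary.Decidable using (decidable-stable)
open import Function.Bundles using (_⇔_; mk⇔; Equivalence)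
open import Function using (_∘_)

private
  variable
    a b y : ℕ
    v w : List ℕ

∈-tail : y ≢ a → a ∈ y ∷ w → a ∈ w
∈-tail y≢a (here a≡y) = ⊥-elim (y≢a (sym a≡y))
∈-tail y≢a (there a∈w) = a∈w

range : ℕ → ℕ → List ℕ
range x zero = []
range x (suc n) = x ∷ range (suc x) n

applyUpTo≡range : ∀ n (f : ℕ → ℕ) x → (∀ i → f i ≡ x + i) → applyUpTo f n ≡ range x n
applyUpTo≡range zero f x f≗x+ = refl
applyUpTo≡range (suc n) f x f≗x+ =
  cong₂ _∷_ (≡.trans (f≗x+ 0) (+-identityʳ x))
            (applyUpTo≡range n (f ∘ suc) (suc x) (λ i → ≡.trans (f≗x+ (suc i)) (+-suc x i)))

ground≡range : ∀ s t → ground s t ≡ range 1 (s * t)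
ground≡range s t = applyUpTo≡range (s * t) suc 1 (λ i → refl)

∈-range⁻ : ∀ x n → a ∈ range x n → x ≤ a × a < x + n
∈-range⁻ x (suc n) (here refl) = ≤-refl , m<m+n x z<s
∈-range⁻ {a} x (suc n) (there a∈) with ∈-range⁻ (suc x) n a∈
... | x<a , a<sx+n = <⇒≤ x<a , subst (a <_) (sym (+-suc x n)) a<sx+n

∈-range⁺ : ∀ x n → x ≤ a → a < x + n → a ∈ range x n
∈-range⁺ {a} x zero x≤a a<x+0 = ⊥-elim (<⇒≱ (subst (a <_) (+-identityʳ x) a<x+0) x≤a)
∈-range⁺ {a} x (suc n) x≤a a<x+sn with x ≟ a
... | yes refl = here refl
... | no x≢a = there (∈-range⁺ (suc x) n (≤∧≢⇒< x≤a x≢a) (subst (a <_) (+-suc x n) a<x+sn))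

range-unique : ∀ x n → Unique (range x n)
range-unique x zero = []
range-unique x (suc n) =
  All.tabulate (λ a∈ → <⇒≢ (proj₁ (∈-range⁻ (suc x) n a∈))) ∷ range-unique (suc x) n

data Before {ℓ} {A : Set ℓ} (a b : A) : List A → Set ℓ where
  here  : ∀ {xs} → b ∈ xs → Before a b (a ∷ xs)
  there : ∀ {x xs} → Before a b xs → Before a b (x ∷ xs)

module _ {ℓ} {A : Set ℓ} where

  Before⇒∈ˡ : ∀ {a b : A} {xs} → Before a b xs → a ∈ xs
  Before⇒∈ˡ (here _) = here refl
  Before⇒∈ˡ (there ab) = there (Before⇒∈ˡ ab)

  Before⇒∈ʳ : ∀ {a b : A} {xs} → Before a b xs → b ∈ xs
  Before⇒∈ʳ (here b∈) = there b∈
  Before⇒∈ʳ (there ab) = there (Before⇒∈ʳ ab)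

  Before-total : ∀ {a b : A} {xs} → a ∈ xs → b ∈ xs → a ≢ b → Before a b xs ⊎ Before b a xs
  Before-total (here refl) (here refl) a≢b = ⊥-elim (a≢b refl)
  Before-total (here refl) (there b∈) a≢b = inj₁ (here b∈)
  Before-total (there a∈) (here refl) a≢b = inj₂ (here a∈)
  Before-total (there a∈) (there b∈) a≢b with Before-total a∈ b∈ a≢b
  ... | inj₁ ab = inj₁ (there ab)
  ... | inj₂ ba = inj₂ (there ba)

  Before-asym : ∀ {a b : A} {xs} → Unique xs → Before a b xs → ¬ Before b a xs
  Before-asym (x∉ ∷ _) (here _) (here a∈) = All.lookup x∉ a∈ refl
  Before-asym (x∉ ∷ _) (here _) (there ba) = All.lookup x∉ (Before⇒∈ʳ ba) refl
  Before-asym (x∉ ∷ _) (there ab) (here _) = All.lookup x∉ (Before⇒∈ʳ ab) refl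
  Before-asym (_ ∷ u) (there ab) (there ba) = Before-asym u ab ba

  AllPairs⇒Before : ∀ {r} {R : A → A → Set r} {a b xs} → AllPairs R xs → Before a b xs → R a b
  AllPairs⇒Before (Rx ∷ _) (here b∈) = All.lookup Rx b∈
  AllPairs⇒Before (_ ∷ Rxs) (there bf) = AllPairs⇒Before Rxs bf

  Before⇒AllPairs : ∀ {r} {R : A → A → Set r} {xs} →
    (∀ {a b} → Before a b xs → R a b) → AllPairs R xs
  Before⇒AllPairs {xs = []} R-before = []
  Before⇒AllPairs {xs = x ∷ xs} R-before =
    All.tabulate (R-before ∘ here) ∷ Before⇒AllPairs (R-before ∘ there)

  Before⇒indices : ∀ {a b : A} (xs : List A) → Before a b xs →
    Σ (Fin (length xs)) λ i → Σ (Fin (length xs)) λ j → (i Fin.< j) × (lookup xs i ≡ a) × (lookup xs j ≡ b)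
  Before⇒indices (a ∷ xs) (here b∈) =
    zero , suc (Any.index b∈) , z<s , refl , sym (lookup-index b∈)
  Before⇒indices (x ∷ xs) (there bf) with Before⇒indices xs bf
  ... | i , j , i<j , xsᵢ≡a , xsⱼ≡b = suc i , suc j , s<s i<j , xsᵢ≡a , xsⱼ≡b

  indices⇒Before : ∀ (xs : List A) (i j : Fin (length xs)) → i Fin.< j →
    Before (lookup xs i) (lookup xs j) xs
  indices⇒Before (x ∷ xs) zero (suc j) _ = here (∈-lookup j)
  indices⇒Before (x ∷ xs) (suc i) (suc j) (s<s i<j) = there (indices⇒Before xs i j i<j)

AtMostOneBelow : ℕ → List ℕ → Set
AtMostOneBelow y w = ∀ {a b} → a ∈ w → b ∈ w → a < y → b < y → a ≡ b

data EachAtMostOneBelow : List ℕ → Set where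
  []  : EachAtMostOneBelow []
  _∷_ : AtMostOneBelow y w → EachAtMostOneBelow w → EachAtMostOneBelow (y ∷ w)

noneBelow : (∀ {a} → a ∈ w → y ≤ a) → AtMostOneBelow y w
noneBelow y≤ a∈ _ a<y _ = ⊥-elim (<⇒≱ a<y (y≤ a∈))

onlyBelow : ∀ c → (∀ {a} → a ∈ w → a < y → a ≡ c) → AtMostOneBelow y w
onlyBelow c below a∈ b∈ a<y b<y = ≡.trans (below a∈ a<y) (sym (below b∈ b<y))

1<2 : 1 < 2
1<2 = s≤s (s≤s z≤n)

1<3 : 1 < 3
1<3 = s≤s (s≤s z≤n)

2<3 : 2 < 3
2<3 = s≤s (s≤s (s≤s z≤n))

sameOrd-< : ∀ {x y p q} → x < y → p < q → SameOrd x y p q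
sameOrd-< x<y p<q = mk⇔ (λ _ → p<q) (λ _ → x<y)

sameOrd-> : ∀ {x y p q} → y < x → q < p → SameOrd x y p q
sameOrd-> y<x q<p = mk⇔ (λ x<y → ⊥-elim (<-asym x<y y<x)) (λ p<q → ⊥-elim (<-asym p<q q<p))

module _ (v : List ℕ) {i j k : Fin (length v)} (i<j : i Fin.< j) (j<k : j Fin.< k) where

  occurrence312 : lookup v j < lookup v k → lookup v k < lookup v i → Contains 3 1 2 v
  occurrence312 vⱼ<vₖ vₖ<vᵢ =
    i , j , k , i<j , j<k ,
    sameOrd-> vⱼ<vᵢ 1<3 , sameOrd-< vⱼ<vᵢ 1<3 ,
    sameOrd-> vₖ<vᵢ 2<3 , sameOrd-< vₖ<vᵢ 2<3 ,
    sameOrd-< vⱼ<vₖ 1<2 , sameOrd-> vⱼ<vₖ 1<2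
    where vⱼ<vᵢ = <-trans vⱼ<vₖ vₖ<vᵢ

  occurrence321 : lookup v k < lookup v j → lookup v j < lookup v i → Contains 3 2 1 v
  occurrence321 vₖ<vⱼ vⱼ<vᵢ =
    i , j , k , i<j , j<k ,
    sameOrd-> vⱼ<vᵢ 2<3 , sameOrd-< vⱼ<vᵢ 2<3 ,
    sameOrd-> vₖ<vᵢ 1<3 , sameOrd-< vₖ<vᵢ 1<3 ,
    sameOrd-> vₖ<vⱼ 1<2 , sameOrd-< vₖ<vⱼ 1<2
    where vₖ<vᵢ = <-trans vₖ<vⱼ vⱼ<vᵢ

contains-∷ : ∀ {p q r} → Contains p q r w → Contains p q r (y ∷ w)
contains-∷ (i , j , k , i<j , j<k , ord) = suc i , suc j , suc k , s<s i<j , s<s j<k , ord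

eachAtMostOneBelow-lookup : ∀ {v} → EachAtMostOneBelow v → ∀ {i j k : Fin (length v)} →
  i Fin.< j → i Fin.< k → lookup v j < lookup v i → lookup v k < lookup v i → lookup v j ≡ lookup v k
eachAtMostOneBelow-lookup {y ∷ w} (oneBelow ∷ _) {zero} {suc j} {suc k} _ _ =
  oneBelow (∈-lookup j) (∈-lookup k)
eachAtMostOneBelow-lookup {y ∷ w} (_ ∷ each) {suc i} {suc j} {suc k} (s<s i<j) (s<s i<k) =
  eachAtMostOneBelow-lookup each i<j i<k

avoids312∧321⇔eachAtMostOneBelow : ∀ v → (Avoids 3 1 2 v × Avoids 3 2 1 v) ⇔ EachAtMostOneBelow v
avoids312∧321⇔eachAtMostOneBelow v = mk⇔ (avoiding⇒each v) each⇒avoiding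
  where
    avoiding⇒each : ∀ v → Avoids 3 1 2 v × Avoids 3 2 1 v → EachAtMostOneBelow v
    avoiding⇒each [] _ = []
    avoiding⇒each (y ∷ w) (no312 , no321) =
      oneBelow ∷ avoiding⇒each w (no312 ∘ contains-∷ , no321 ∘ contains-∷)
      where
        occurs : ∀ {c d} → c ≢ d → Before c d w → c < y → d < y → ⊥
        occurs c≢d cd c<y d<y with Before⇒indices w cd
        ... | j , k , j<k , refl , refl with <-cmp (lookup w j) (lookup w k)
        ... | tri< c<d _ _ = no312 (occurrence312 (y ∷ w) z<s (s<s j<k) c<d d<y)
        ... | tri≈ _ c≡d _ = c≢d c≡d
        ... | tri> _ _ d<c = no321 (occurrence321 (y ∷ w) z<s (s<s j<k) d<c c<y)

        oneBelow : AtMostOneBelow y w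
        oneBelow {a} {b} a∈ b∈ a<y b<y with a ≟ b
        ... | yes a≡b = a≡b
        ... | no a≢b with Before-total a∈ b∈ a≢b
        ... | inj₁ ab = ⊥-elim (occurs a≢b ab a<y b<y)
        ... | inj₂ ba = ⊥-elim (occurs (a≢b ∘ sym) ba b<y a<y)

    each⇒avoiding : EachAtMostOneBelow v → Avoids 3 1 2 v × Avoids 3 2 1 v
    each⇒avoiding each = no312 , no321
      where
        no312 : Avoids 3 1 2 v
        no312 (i , j , k , i<j , j<k , _ , vⱼ<vᵢ , _ , vₖ<vᵢ , vⱼ<vₖ , _) =
          <-irrefl (eachAtMostOneBelow-lookup each i<j (Fin.<-trans i<j j<k)
                     (Equivalence.from vⱼ<vᵢ 1<3) (Equivalence.from vₖ<vᵢ 2<3))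
                   (Equivalence.from vⱼ<vₖ 1<2)
        no321 : Avoids 3 2 1 v
        no321 (i , j , k , i<j , j<k , _ , vⱼ<vᵢ , _ , vₖ<vᵢ , _ , vₖ<vⱼ) =
          <-irrefl (sym (eachAtMostOneBelow-lookup each i<j (Fin.<-trans i<j j<k)
                          (Equivalence.from vⱼ<vᵢ 2<3) (Equivalence.from vₖ<vᵢ 1<3)))
                   (Equivalence.from vₖ<vⱼ 1<2)

module _ {ℓ} {A : Set ℓ} where

  onlyIf : ∀ {p} {P : Set p} → Dec P → List A → List A
  onlyIf (yes _) xs = xs
  onlyIf (no _) xs = []

  ∈-onlyIf⁺ : ∀ {p} {P : Set p} (P? : Dec P) {xs} {x : A} → P → x ∈ xs → x ∈ onlyIf P? xs
  ∈-onlyIf⁺ (yes _) _ x∈ = x∈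
  ∈-onlyIf⁺ (no ¬p) p _ = ⊥-elim (¬p p)

  ∈-onlyIf⁻ : ∀ {p} {P : Set p} (P? : Dec P) {xs} {x : A} → x ∈ onlyIf P? xs → P × x ∈ xs
  ∈-onlyIf⁻ (yes p) x∈ = p , x∈

  onlyIf-unique : ∀ {p} {P : Set p} (P? : Dec P) {xs} → Unique xs → Unique (onlyIf P? xs)
  onlyIf-unique (yes _) u = u
  onlyIf-unique (no _) _ = []

  onlyIf-disjoint : ∀ {p} {P : Set p} (P? : Dec P) {xs ys} → Disjoint xs ys → Disjoint xs (onlyIf P? ys)
  onlyIf-disjoint (yes _) disj = disj
  onlyIf-disjoint (no _) _ (_ , ())

  length-onlyIf-yes : ∀ {p} {P : Set p} (P? : Dec P) {xs : List A} → P → length (onlyIf P? xs) ≡ length xs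
  length-onlyIf-yes (yes _) _ = refl
  length-onlyIf-yes (no ¬p) p = ⊥-elim (¬p p)

  length-onlyIf-no : ∀ {p} {P : Set p} (P? : Dec P) {xs : List A} → ¬ P → length (onlyIf P? xs) ≡ 0
  length-onlyIf-no (yes p) ¬p = ⊥-elim (¬p p)
  length-onlyIf-no (no _) _ = refl

  ∈-map-∷⁻ : ∀ {p} {P : List A → Set p} {a : A} {xss v} →
    (∀ {xs} → xs ∈ xss → P (a ∷ xs)) → v ∈ map (a ∷_) xss → P v
  ∈-map-∷⁻ P-∷ v∈ with ∈-map⁻ _ v∈
  ... | xs , xs∈ , refl = P-∷ xs∈

  map-∷-unique : ∀ {a : A} {xss} → Unique xss → Unique (map (a ∷_) xss)
  map-∷-unique = Unique.map⁺ ∷-injectiveʳ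

  map-∷-disjoint : ∀ {a b : A} {xss yss} → a ≢ b → Disjoint (map (a ∷_) xss) (map (b ∷_) yss)
  map-∷-disjoint a≢b (v∈ , v∈′) with ∈-map⁻ _ v∈ | ∈-map⁻ _ v∈′
  ... | _ , _ , refl | _ , _ , a∷xs≡b∷ys = a≢b (proj₁ (∷-injective a∷xs≡b∷ys))

  length-map-∷-++ : ∀ (a b : A) (xss yss : List (List A)) →
    length (map (a ∷_) xss ++ map (b ∷_) yss) ≡ length xss + length yss
  length-map-∷-++ a b xss yss =
    ≡.trans (length-++ (map (a ∷_) xss)) (cong₂ _+_ (length-map (a ∷_) xss) (length-map (b ∷_) yss))

-- t is the tooth length; the multiples of t are the tooth tops.
module Arrangements (t : ℕ) where

  -- Arrangement r x v: v arranges the interval [x, x + r), each step either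
  -- placing x or, when x is a tooth top, putting x + 1 first and carrying x
  -- along as a delayed entry.  Delayed r lo x v: v arranges the delayed lo
  -- together with [x, x + r).
  data Arrangement : ℕ → ℕ → List ℕ → Set
  data Delayed : ℕ → ℕ → ℕ → List ℕ → Set

  data Arrangement where
    []    : ∀ {x} → Arrangement 0 x []
    keep  : ∀ {r x v} → Arrangement r (suc x) v → Arrangement (suc r) x (x ∷ v)
    delay : ∀ {r x v} → t ∣ x → Delayed r x (suc (suc x)) v → Arrangement (suc (suc r)) x (suc x ∷ v)

  data Delayed where
    release : ∀ {r lo x v} → Arrangement r x v → Delayed r lo x (lo ∷ v)
    pass    : ∀ {r lo x v} → Delayed r lo (suc x) v → Delayed (suc r) lo x (x ∷ v)

  arrangement-↭ : ∀ {r x v} → Arrangement r x v → v ↭ range x r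
  delayed-↭ : ∀ {r lo x v} → Delayed r lo x v → v ↭ lo ∷ range x r

  arrangement-↭ [] = ↭-refl
  arrangement-↭ (keep arr) = ↭-prep _ (arrangement-↭ arr)
  arrangement-↭ (delay _ del) = ↭-trans (↭-prep _ (delayed-↭ del)) (↭-swap _ _ ↭-refl)

  delayed-↭ (release arr) = ↭-prep _ (arrangement-↭ arr)
  delayed-↭ (pass del) = ↭-trans (↭-prep _ (delayed-↭ del)) (↭-swap _ _ ↭-refl)

  arrangement-≥ : ∀ {r x v} → Arrangement r x v → a ∈ v → x ≤ a
  arrangement-≥ arr a∈ = proj₁ (∈-range⁻ _ _ (∈-resp-↭ (arrangement-↭ arr) a∈))

  delayed-below : ∀ {r lo x v} → Delayed r lo x v → a ∈ v → a < x → a ≡ lo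
  delayed-below del a∈ a<x with ∈-resp-↭ (delayed-↭ del) a∈
  ... | here a≡lo = a≡lo
  ... | there a∈range = ⊥-elim (<⇒≱ a<x (proj₁ (∈-range⁻ _ _ a∈range)))

  arrangement-oneBelow : ∀ {r x v} → Arrangement r x v → EachAtMostOneBelow v
  delayed-oneBelow : ∀ {r lo x v} → Delayed r lo x v → lo < x → EachAtMostOneBelow v

  arrangement-oneBelow [] = []
  arrangement-oneBelow (keep arr) = noneBelow (<⇒≤ ∘ arrangement-≥ arr) ∷ arrangement-oneBelow arr
  arrangement-oneBelow (delay {x = x} _ del) =
    onlyBelow x (λ a∈ a<1+x → delayed-below del a∈ (m<n⇒m<1+n a<1+x))
    ∷ delayed-oneBelow del (m<n⇒m<1+n (n<1+n x))

  delayed-oneBelow (release arr) lo<x =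
    noneBelow (λ a∈ → <⇒≤ (<-≤-trans lo<x (arrangement-≥ arr a∈))) ∷ arrangement-oneBelow arr
  delayed-oneBelow {lo = lo} (pass del) lo<x =
    onlyBelow lo (λ a∈ a<x → delayed-below del a∈ (m<n⇒m<1+n a<x)) ∷ delayed-oneBelow del (m<n⇒m<1+n lo<x)

  TopInversion : ℕ → ℕ → Set
  TopInversion y a = a < y → t ∣ a

  arrangement-inversions : ∀ {r x v} → Arrangement r x v → AllPairs TopInversion v
  delayed-inversions : ∀ {r lo x v} → Delayed r lo x v → t ∣ lo → lo < x → AllPairs TopInversion v

  arrangement-inversions [] = []
  arrangement-inversions (keep arr) =
    All.tabulate (λ a∈ a<x → ⊥-elim (<-asym a<x (arrangement-≥ arr a∈))) ∷ arrangement-inversions arr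
  arrangement-inversions (delay {x = x} t∣x del) =
    All.tabulate (λ a∈ a<1+x → subst (t ∣_) (sym (delayed-below del a∈ (m<n⇒m<1+n a<1+x))) t∣x)
    ∷ delayed-inversions del t∣x (m<n⇒m<1+n (n<1+n x))

  delayed-inversions (release arr) _ lo<x =
    All.tabulate (λ a∈ a<lo → ⊥-elim (<⇒≱ (<-trans a<lo lo<x) (arrangement-≥ arr a∈)))
    ∷ arrangement-inversions arr
  delayed-inversions (pass del) t∣lo lo<x =
    All.tabulate (λ a∈ a<x → subst (t ∣_) (sym (delayed-below del a∈ (m<n⇒m<1+n a<x))) t∣lo)
    ∷ delayed-inversions del t∣lo (m<n⇒m<1+n lo<x)

  topInversions⇒Before : AllPairs TopInversion v → a < b → ¬ t ∣ a → a ∈ v → b ∈ v → Before a b v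
  topInversions⇒Before inversions a<b t∤a a∈ b∈ with Before-total a∈ b∈ (<⇒≢ a<b)
  ... | inj₁ ab = ab
  ... | inj₂ ba = ⊥-elim (t∤a (AllPairs⇒Before inversions ba a<b))

  TopReversal : ℕ → ℕ → Set
  TopReversal y a = y ≡ suc a → t ∣ a

  -- Both x and y - 1 would follow y and lie below it.
  ¬gap : ∀ {r x} → y ∷ w ↭ range x r → AtMostOneBelow y w → suc x < y → ⊥
  ¬gap {suc z} {w} {r} {x} p oneBelow (s≤s x<z) =
    <-irrefl (oneBelow (later ≤-refl x<1+z) (later (<⇒≤ x<z) (n<1+n z)) x<1+z (n<1+n z)) x<z
    where
      x<1+z : x < suc z
      x<1+z = m<n⇒m<1+n x<z
      1+z<x+r : suc z < x + r
      1+z<x+r = proj₂ (∈-range⁻ x r (∈-resp-↭ p (here refl)))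
      later : ∀ {a} → x ≤ a → a < suc z → a ∈ w
      later x≤a a<1+z =
        ∈-tail (>⇒≢ a<1+z) (∈-resp-↭ (↭-sym p) (∈-range⁺ x r x≤a (<-trans a<1+z 1+z<x+r)))

  -- Both lo and x would follow y and lie below it.
  ¬overtake : ∀ {r lo x} → lo < x → y ∷ w ↭ lo ∷ range x r → AtMostOneBelow y w → x < y → ⊥
  ¬overtake {y} {w} {r} {lo} {x} lo<x p oneBelow x<y =
    <⇒≢ lo<x (oneBelow (later (here refl) lo<y) (later (there x∈range) x<y) lo<y x<y)
    where
      lo<y : lo < y
      lo<y = <-trans lo<x x<y
      later : ∀ {a} → a ∈ lo ∷ range x r → a < y → a ∈ w
      later a∈ a<y = ∈-tail (>⇒≢ a<y) (∈-resp-↭ (↭-sym p) a∈)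
      x∈range : x ∈ range x r
      x∈range with ∈-resp-↭ p (here refl)
      ... | here y≡lo = ⊥-elim (>⇒≢ lo<y y≡lo)
      ... | there y∈range = ∈-range⁺ x r ≤-refl (<-trans x<y (proj₂ (∈-range⁻ x r y∈range)))

  arrangement-complete : ∀ {r x v} → v ↭ range x r → EachAtMostOneBelow v → AllPairs TopReversal v →
    Arrangement r x v
  delayed-complete : ∀ {r lo x v} → lo < x → v ↭ lo ∷ range x r →
    EachAtMostOneBelow v → AllPairs TopReversal v → Delayed r lo x v

  arrangement-complete {zero} p _ _ with ↭-empty-inv p
  ... | refl = []
  arrangement-complete {suc zero} p _ _ with ↭-singleton-inv p
  ... | refl = keep []
  arrangement-complete {suc (suc r)} {v = []} p _ _ = ⊥-elim (¬x∷xs↭[] (↭-sym p))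
  arrangement-complete {suc (suc r)} {x} {y ∷ w} p (oneBelow ∷ below) (reversals ∷ order)
    with y ≟ x | y ≟ suc x
  ... | yes refl | _ = keep (arrangement-complete (drop-∷ p) below order)
  ... | no y≢x | yes refl =
    delay (All.lookup reversals (∈-tail y≢x (∈-resp-↭ (↭-sym p) (here refl))) refl)
          (delayed-complete (m<n⇒m<1+n (n<1+n x)) (drop-∷ (↭-trans p (↭-swap x (suc x) ↭-refl))) below order)
  ... | no y≢x | no y≢1+x =
    ⊥-elim (¬gap p oneBelow (≤∧≢⇒< (≤∧≢⇒< x≤y (y≢x ∘ sym)) (y≢1+x ∘ sym)))
    where
      x≤y : x ≤ y
      x≤y = proj₁ (∈-range⁻ x (suc (suc r)) (∈-resp-↭ p (here refl)))

  delayed-complete {zero} _ p _ _ with ↭-singleton-inv p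
  ... | refl = release []
  delayed-complete {suc r} {v = []} _ p _ _ = ⊥-elim (¬x∷xs↭[] (↭-sym p))
  delayed-complete {suc r} {lo} {x} {y ∷ w} lo<x p (oneBelow ∷ below) (_ ∷ order)
    with y ≟ lo | y ≟ x
  ... | yes refl | _ = release (arrangement-complete (drop-∷ p) below order)
  ... | no _ | yes refl =
    pass (delayed-complete (m<n⇒m<1+n lo<x) (drop-∷ (↭-trans p (↭-swap lo x ↭-refl))) below order)
  ... | no y≢lo | no y≢x = ⊥-elim (¬overtake lo<x p oneBelow (≤∧≢⇒< x≤y (y≢x ∘ sym)))
    where
      x≤y : x ≤ y
      x≤y = proj₁ (∈-range⁻ x (suc r) (∈-tail (y≢lo ∘ sym) (∈-resp-↭ p (here refl))))

  arrangements : ℕ → ℕ → List (List ℕ)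
  delayedArrangements : ℕ → ℕ → ℕ → List (List ℕ)

  arrangements zero x = [ [] ]
  arrangements (suc zero) x = [ [ x ] ]
  arrangements (suc (suc r)) x =
    map (x ∷_) (arrangements (suc r) (suc x)) ++
    onlyIf (t ∣? x) (map (suc x ∷_) (delayedArrangements r x (suc (suc x))))

  delayedArrangements zero lo x = [ [ lo ] ]
  delayedArrangements (suc r) lo x =
    map (lo ∷_) (arrangements (suc r) x) ++ map (x ∷_) (delayedArrangements r lo (suc x))

  ∈-arrangements⁺ : ∀ {r x v} → Arrangement r x v → v ∈ arrangements r x
  ∈-delayedArrangements⁺ : ∀ {r lo x v} → Delayed r lo x v → v ∈ delayedArrangements r lo x

  ∈-arrangements⁺ [] = here refl
  ∈-arrangements⁺ {suc zero} (keep []) = here refl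
  ∈-arrangements⁺ {suc (suc r)} (keep arr) = ∈-++⁺ˡ (∈-map⁺ (_ ∷_) (∈-arrangements⁺ arr))
  ∈-arrangements⁺ (delay {r} {x} t∣x del) =
    ∈-++⁺ʳ (map (x ∷_) (arrangements (suc r) (suc x)))
           (∈-onlyIf⁺ (t ∣? x) t∣x (∈-map⁺ (_ ∷_) (∈-delayedArrangements⁺ del)))

  ∈-delayedArrangements⁺ {zero} (release []) = here refl
  ∈-delayedArrangements⁺ {suc r} (release arr) = ∈-++⁺ˡ (∈-map⁺ (_ ∷_) (∈-arrangements⁺ arr))
  ∈-delayedArrangements⁺ (pass {r} {lo} {x} del) =
    ∈-++⁺ʳ (map (lo ∷_) (arrangements (suc r) x)) (∈-map⁺ (_ ∷_) (∈-delayedArrangements⁺ del))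

  ∈-arrangements⁻ : ∀ r x → v ∈ arrangements r x → Arrangement r x v
  ∈-delayedArrangements⁻ : ∀ r lo x → v ∈ delayedArrangements r lo x → Delayed r lo x v

  ∈-arrangements⁻ zero x (here refl) = []
  ∈-arrangements⁻ (suc zero) x (here refl) = keep []
  ∈-arrangements⁻ (suc (suc r)) x v∈ =
    [ ∈-map-∷⁻ {P = Arrangement (suc (suc r)) x} (keep ∘ ∈-arrangements⁻ (suc r) (suc x))
    , (λ v∈delay → let t∣x , v∈delay′ = ∈-onlyIf⁻ (t ∣? x) v∈delay in
         ∈-map-∷⁻ {P = Arrangement (suc (suc r)) x}
                  (delay t∣x ∘ ∈-delayedArrangements⁻ r x (suc (suc x))) v∈delay′)
    ]′ (∈-++⁻ (map (x ∷_) (arrangements (suc r) (suc x))) v∈)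

  ∈-delayedArrangements⁻ zero lo x (here refl) = release []
  ∈-delayedArrangements⁻ (suc r) lo x v∈ =
    [ ∈-map-∷⁻ {P = Delayed (suc r) lo x} (release ∘ ∈-arrangements⁻ (suc r) x)
    , ∈-map-∷⁻ {P = Delayed (suc r) lo x} (pass ∘ ∈-delayedArrangements⁻ r lo (suc x))
    ]′ (∈-++⁻ (map (lo ∷_) (arrangements (suc r) x)) v∈)

  arrangements-unique : ∀ r x → Unique (arrangements r x)
  delayedArrangements-unique : ∀ r lo x → lo < x → Unique (delayedArrangements r lo x)

  arrangements-unique zero x = [] ∷ []
  arrangements-unique (suc zero) x = [] ∷ []
  arrangements-unique (suc (suc r)) x =
    Unique.++⁺ (map-∷-unique (arrangements-unique (suc r) (suc x)))
               (onlyIf-unique (t ∣? x)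
                  (map-∷-unique (delayedArrangements-unique r x (suc (suc x)) (m<n⇒m<1+n (n<1+n x)))))
               (onlyIf-disjoint (t ∣? x) (map-∷-disjoint (<⇒≢ (n<1+n x))))

  delayedArrangements-unique zero lo x _ = [] ∷ []
  delayedArrangements-unique (suc r) lo x lo<x =
    Unique.++⁺ (map-∷-unique (arrangements-unique (suc r) x))
               (map-∷-unique (delayedArrangements-unique r lo (suc x) (m<n⇒m<1+n lo<x)))
               (map-∷-disjoint (<⇒≢ lo<x))

  length-arrangements-top : ∀ r {x} → t ∣ x → length (arrangements (suc (suc r)) x) ≡
    length (arrangements (suc r) (suc x)) + length (delayedArrangements r x (suc (suc x)))
  length-arrangements-top r {x} t∣x =
    ≡.trans (length-++ (map (x ∷_) (arrangements (suc r) (suc x))))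
            (cong₂ _+_ (length-map (x ∷_) (arrangements (suc r) (suc x)))
                       (≡.trans (length-onlyIf-yes (t ∣? x) t∣x)
                                (length-map (suc x ∷_) (delayedArrangements r x (suc (suc x))))))

  length-arrangements-nontop : ∀ r {x} → ¬ t ∣ x →
    length (arrangements (suc (suc r)) x) ≡ length (arrangements (suc r) (suc x))
  length-arrangements-nontop r {x} t∤x =
    ≡.trans (length-++ (map (x ∷_) (arrangements (suc r) (suc x))))
            (≡.trans (cong₂ _+_ (length-map (x ∷_) (arrangements (suc r) (suc x)))
                                (length-onlyIf-no (t ∣? x) t∤x))
                     (+-identityʳ _))

  length-delayedArrangements-suc : ∀ r {lo x} → length (delayedArrangements (suc r) lo x) ≡
    length (arrangements (suc r) x) + length (delayedArrangements r lo (suc x))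
  length-delayedArrangements-suc r {lo} {x} =
    length-map-∷-++ lo x (arrangements (suc r) x) (delayedArrangements r lo (suc x))

module Counting (t′ : ℕ) where

  t : ℕ
  t = suc (suc t′)

  open Arrangements t

  -- Both are x + t, in the shapes the recursion produces.
  next-top₁ : ∀ {x} → t ∣ x → t ∣ suc x + suc t′
  next-top₁ {x} t∣x = subst (t ∣_) (+-suc x (suc t′)) (∣m∣n⇒∣m+n t∣x ∣-refl)

  next-top₂ : ∀ {x} → t ∣ x → t ∣ suc (suc x) + t′
  next-top₂ {x} t∣x = subst (t ∣_) (cong suc (+-suc x t′)) (next-top₁ t∣x)

  -- The interval [x, x + 1 + u + q t) contains the tops x + u, …, x + u + q t;
  -- the last one ends the interval, so q of them can be delayed.
  length-arrangements : ∀ q u x → u < t → t ∣ x + u →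
    length (arrangements (suc (u + q * t)) x) ≡ (t + 1) ^ q
  length-delayedArrangements : ∀ q u lo x → u < t → t ∣ x + u →
    length (delayedArrangements (suc (u + q * t)) lo x) ≡ (u + 2) * (t + 1) ^ q

  length-arrangements zero zero x _ _ = refl
  length-arrangements q (suc u) x 1+u<t t∣x+1+u =
    ≡.trans (length-arrangements-nontop (u + q * t) t∤x)
            (length-arrangements q u (suc x) (<-trans (n<1+n u) 1+u<t) (subst (t ∣_) (+-suc x u) t∣x+1+u))
    where
      t∤x : ¬ t ∣ x
      t∤x t∣x = <⇒≱ 1+u<t (∣⇒≤ (∣m+n∣m⇒∣n t∣x+1+u t∣x))
  length-arrangements (suc q) zero x _ t∣x+0 = begin
    length (arrangements (suc (t + q * t)) x)
      ≡⟨ length-arrangements-top (suc t′ + q * t) t∣x ⟩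
    length (arrangements (suc (suc t′ + q * t)) (suc x))
      + length (delayedArrangements (suc t′ + q * t) x (suc (suc x)))
      ≡⟨ cong₂ _+_ (length-arrangements q (suc t′) (suc x) ≤-refl (next-top₁ t∣x))
                   (length-delayedArrangements q t′ x (suc (suc x)) (m<n⇒m<1+n (n<1+n t′)) (next-top₂ t∣x)) ⟩
    (suc t′ + 2) * (t + 1) ^ q
      ≡⟨ cong (λ n → suc n * (t + 1) ^ q) (+-suc t′ 1) ⟩
    (t + 1) ^ suc q ∎
    where
      open ≡.≡-Reasoning
      t∣x : t ∣ x
      t∣x = subst (t ∣_) (+-identityʳ x) t∣x+0

  length-delayedArrangements zero zero lo x _ _ = refl
  length-delayedArrangements q (suc u) lo x 1+u<t t∣x+1+u =
    ≡.trans (length-delayedArrangements-suc (suc u + q * t))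
            (cong₂ _+_ (length-arrangements q (suc u) x 1+u<t t∣x+1+u)
                       (length-delayedArrangements q u lo (suc x) (<-trans (n<1+n u) 1+u<t)
                          (subst (t ∣_) (+-suc x u) t∣x+1+u)))
  length-delayedArrangements (suc q) zero lo x t>0 t∣x+0 = begin
    length (delayedArrangements (suc (t + q * t)) lo x)
      ≡⟨ length-delayedArrangements-suc (t + q * t) ⟩
    length (arrangements (suc (t + q * t)) x)
      + length (delayedArrangements (suc (suc t′ + q * t)) lo (suc x))
      ≡⟨ cong₂ _+_ (length-arrangements (suc q) zero x t>0 t∣x+0)
                   (length-delayedArrangements q (suc t′) lo (suc x) ≤-refl
                      (next-top₁ (subst (t ∣_) (+-identityʳ x) t∣x+0))) ⟩
    (t + 1) ^ suc q + (suc t′ + 2) * (t + 1) ^ q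
      ≡⟨ cong (λ n → (t + 1) ^ suc q + suc n * (t + 1) ^ q) (+-suc t′ 1) ⟩
    (t + 1) ^ suc q + (t + 1) ^ suc q
      ≡⟨ cong ((t + 1) ^ suc q +_) (sym (+-identityʳ _)) ⟩
    2 * (t + 1) ^ suc q ∎
    where open ≡.≡-Reasoning

module Comb (s t′ : ℕ) where

  t : ℕ
  t = suc (suc t′)

  open Arrangements t public

  tooth-cover : ∀ {x} → ¬ t ∣ x → suc x ≤ s * t → Cover s t x (suc x)
  tooth-cover {x} t∤x 1+x≤st =
    subst₂ (Cover s t) (sym x≡) (≡.trans (cong (_+ 1) (sym x≡)) (+-comm x 1))
      (tooth (x / t) (x % t) (m<n*o⇒m/o<n {x} {s} {t} 1+x≤st) 1≤x%t (m%n<n x t))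
    where
      x≡ : x ≡ x / t * t + x % t
      x≡ = ≡.trans (m≡m%n+[m/n]*n x t) (+-comm (x % t) (x / t * t))
      1≤x%t : 1 ≤ x % t
      1≤x%t = ≤∧≢⇒< z≤n (λ 0≡x%t → t∤x (m%n≡0⇒n∣m x t (sym 0≡x%t)))

  -- Necessary conditions for a < b in the comb.
  Precedes : ℕ → ℕ → Set
  Precedes a b = 1 ≤ a × a < b × b ≤ s * t × ¬ t ∣ a

  cover⇒Precedes : Cover s t a b → Precedes a b
  cover⇒Precedes (spine c 1+c<s) =
    m≤n+m 1 (c * t) ,
    +-monoˡ-< 1 (m<n+m (c * t) {t} z<s) ,
    ≤-trans (+-monoʳ-≤ (t + c * t) {1} {t} z<s)
      (≤-trans (≤-reflexive (+-comm (t + c * t) t)) (*-monoˡ-≤ t 1+c<s)) ,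
    λ t∣ct+1 → <⇒≱ (s<s z<s) (∣⇒≤ (∣m+n∣m⇒∣n t∣ct+1 (n∣m*n c)))
  cover⇒Precedes (tooth c (suc j) c<s _ 1+j<t) =
    ≤-trans z<s (m≤n+m (suc j) (c * t)) ,
    m<m+n (c * t + suc j) z<s ,
    ≤-trans (≤-reflexive (+-assoc (c * t) (suc j) 1))
      (≤-trans (+-monoʳ-≤ (c * t) (subst (_≤ t) (+-comm 1 (suc j)) 1+j<t))
        (≤-trans (≤-reflexive (+-comm (c * t) t)) (*-monoˡ-≤ t c<s))) ,
    λ t∣ct+j → <⇒≱ 1+j<t (∣⇒≤ (∣m+n∣m⇒∣n t∣ct+j (n∣m*n c)))

  ≤β⇒Precedes : a ≤β[ s , t ] b → a ≢ b → Precedes a b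
  ≤β⇒Precedes ε a≢a = ⊥-elim (a≢a refl)
  ≤β⇒Precedes (a⋖c ◅ c≤b) _ with cover⇒Precedes a⋖c
  ... | 1≤a , a<c , c≤st , t∤a =
    let c≤b , b≤st = climb c≤b c≤st in 1≤a , <-≤-trans a<c c≤b , b≤st , t∤a
    where
      climb : ∀ {c b} → c ≤β[ s , t ] b → c ≤ s * t → c ≤ b × b ≤ s * t
      climb ε c≤st = ≤-refl , c≤st
      climb (c⋖d ◅ d≤b) _ with cover⇒Precedes c⋖d
      ... | _ , c<d , d≤st , _ = let d≤b , b≤st = climb d≤b d≤st in ≤-trans (<⇒≤ c<d) d≤b , b≤st

  arrangement⇒linearExtension : Arrangement (s * t) 1 v → IsLinearExtension s t v
  arrangement⇒linearExtension {v} arr =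
    subst (v ↭_) (sym (ground≡range s t)) (arrangement-↭ arr) , ordered
    where
      ∈v : 1 ≤ a → a ≤ s * t → a ∈ v
      ∈v 1≤a a≤st = ∈-resp-↭ (↭-sym (arrangement-↭ arr)) (∈-range⁺ 1 (s * t) 1≤a (s≤s a≤st))
      ordered : ∀ a b → a ≤β[ s , t ] b → a ≢ b →
        Σ (Fin (length v)) λ i → Σ (Fin (length v)) λ j → (i Fin.< j) × (lookup v i ≡ a) × (lookup v j ≡ b)
      ordered a b a≤b a≢b with ≤β⇒Precedes a≤b a≢b
      ... | 1≤a , a<b , b≤st , t∤a =
        Before⇒indices v (topInversions⇒Before (arrangement-inversions arr) a<b t∤a
          (∈v 1≤a (<⇒≤ (<-≤-trans a<b b≤st))) (∈v (≤-trans 1≤a (<⇒≤ a<b)) b≤st))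

  linearExtension⇒arrangement : IsLinearExtension s t v → EachAtMostOneBelow v → Arrangement (s * t) 1 v
  linearExtension⇒arrangement {v} (v↭ground , ordered) each =
    arrangement-complete v↭ each (Before⇒AllPairs reversal)
    where
      v↭ : v ↭ range 1 (s * t)
      v↭ = subst (v ↭_) (ground≡range s t) v↭ground
      reversal : ∀ {y a} → Before y a v → TopReversal y a
      reversal {a = a} 1+a⋯a refl =
        decidable-stable (t ∣? a) λ t∤a → Before-asym unique (a⋯1+a t∤a) 1+a⋯a
        where
          unique : Unique v
          unique = Unique-resp-↭ (↭⇒↭ₛ (↭-sym v↭)) (range-unique 1 (s * t))
          1+a≤st : suc a ≤ s * t
          1+a≤st = ≤-pred (proj₂ (∈-range⁻ 1 (s * t) (∈-resp-↭ v↭ (Before⇒∈ˡ 1+a⋯a))))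
          a⋯1+a : ¬ t ∣ a → Before a (suc a) v
          a⋯1+a t∤a with ordered a (suc a) (tooth-cover t∤a 1+a≤st ◅ ε) (<⇒≢ (n<1+n a))
          ... | i , j , i<j , vᵢ≡a , vⱼ≡1+a =
            subst₂ (λ c d → Before c d v) vᵢ≡a vⱼ≡1+a (indices⇒Before v i j i<j)

  ∈-arrangements⇔ : ∀ v →
    v ∈ arrangements (s * t) 1 ⇔ (IsLinearExtension s t v × Avoids 3 1 2 v × Avoids 3 2 1 v)
  ∈-arrangements⇔ v = mk⇔
    (λ v∈ → let arr = ∈-arrangements⁻ (s * t) 1 v∈ in
       arrangement⇒linearExtension arr , from (arrangement-oneBelow arr))
    (λ (ext , avoiding) → ∈-arrangements⁺ (linearExtension⇒arrangement ext (to avoiding)))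
    where open Equivalence (avoids312∧321⇔eachAtMostOneBelow v)

theorem22 : (s t : ℕ) → 1 ≤ s → 2 ≤ t →
    Σ (List (List ℕ)) λ L →
      Unique L ×
      (∀ v → (v ∈ L) ⇔ (IsLinearExtension s t v × Avoids 3 1 2 v × Avoids 3 2 1 v)) ×
      (length L ≡ (t + 1) ^ (s ∸ 1))
theorem22 (suc s′) (suc (suc t′)) (s≤s z≤n) (s≤s (s≤s z≤n)) =
  arrangements (suc s′ * t) 1 ,
  arrangements-unique (suc s′ * t) 1 ,
  ∈-arrangements⇔ ,
  length-arrangements s′ (suc t′) 1 ≤-refl ∣-refl
  where
    open Comb (suc s′) t′
    open Counting t′ using (length-arrangements)
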